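{- For every positive integer $n$, each of the following statistics on $S_n$ is homomesic with respect to the reverse map $\mathcal{R}$, while, for each of them, there is some $n$ for which it is not homomesic on $S_n$ with respect to the complement map $\mathcal{C}$: (1) the load of $\sigma$, defined as $\mathrm{maj}(\mathcal{R}(\sigma^{ -1}))$; (2) the inverse major index $\mathrm{maj}(\sigma^{ -1})$; (3) the disorder of $\sigma$; (4) the inversion index of $\sigma$; (5) the makl of $\sigma$.
   Context: Homomesy: given a finite set $S$, a bijection $\mathcal{X}:S\to S$ and $f:S\to\mathbb{Z}$, $f$ is homomesic if there is a constant $c$ such that for every orbit $\mathcal{O}$ of $\mathcal{X}$, $\frac{1}{|\mathcal{O}|}\sum_{x\in\mathcal{O}}f(x)=c$. For $\sigma\in S_n$ in one-line notation: $\mathcal{R}(\sigma)_i=\sigma_{n+1-i}$, $\mathcal{C}(\sigma)_i=n+1-\sigma_i$. $\mathrm{maj}(\pi)$ is the sum of the indices $i\in[n-1]$ with $\pi_i>\pi_{i+1}$. The disorder: pass cyclically through $\sigma$ from left to right, removing the values $1,2,\dots,n$ in that order (each pass removes the next needed values as they are encountered); the disorder is the total, over all positions, of the number of passes in which that position is not removed (e.g. for $12543$ it equals $3$). The inversion index is $\sum \sigma_i$ over all pairs $i<j$ with $\sigma_i>\sigma_j$. An occurrence of a vincular pattern $a\text{ - }bc$ (resp. $ab\text{ - }c$) is a triple of positions $i_1<i_2<i_3$ with $\sigma_{i_1}\sigma_{i_2}\sigma_{i_3}$ in the same relative order as $abc$ and $i_3=i_2+1$ (resp. $i_2=i_1+1$).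 The makl is the total number of occurrences of $1\text{ - }32$, $31\text{ - }2$, $32\text{ - }1$ plus the number of descents (occurrences of the consecutive pattern $21$). -}

module Defs where

open import Data.Nat using (ℕ; zero; suc; _+_; _*_; _∸_; _≤_; _<_; _<ᵇ_; _≡ᵇ_)
open import Data.Integer using (ℤ; +_) renaming (_*_ to _*ℤ_)
open import Data.Bool using (Bool; true; false; if_then_else_)
open import Data.List using (List; []; _∷_; _++_; [_]; length; map; upTo; reverse)
open import Data.List.Relation.Binary.Permutation.Propositional using (_↭_)
open import Data.Product using (Σ; ∃; _×_)
open import Relation.Binary.PropositionalEquality using (_≡_; _≢_)
open import Relation.Nullary using (¬_)

iter : {A : Set} → (A → A) → ℕ → A → A
iter X zero    x = x
iter X (suc k) x = X (iter X k x)

OrbitSize : {A : Set} → (A → A) → A → ℕ → Set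
OrbitSize X x k =
  (1 ≤ k) × (iter X k x ≡ x) × (∀ j → 1 ≤ j → j < k → iter X j x ≢ x)

orbitSum : {A : Set} → (A → ℤ) → (A → A) → A → ℕ → ℤ
orbitSum f X x zero    = + 0
orbitSum f X x (suc k) = orbitSum f X x k Data.Integer.+ f (iter X k x)

-- f is homomesic on the finite set S (a predicate on A, invariant under
-- the bijection X): there is a rational constant c = p / q (q ≥ 1) such that
-- for every orbit O,  (1/|O|) Σ_{x ∈ O} f x = c,
-- i.e.  q · Σ_{x∈O} f x = p · |O|.
Homomesic : {A : Set} → (S : A → Set) → (X : A → A) → (f : A → ℤ) → Set
Homomesic {A} S X f =
  Σ ℤ λ p → Σ ℕ λ q → (1 ≤ q) ×
    (∀ (x : A) → S x → ∀ k → OrbitSize X x k →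
       (+ q) *ℤ orbitSum f X x k ≡ p *ℤ (+ k))

-- Permutations in one-line notation: lists of values 1..n

oneTo : ℕ → List ℕ
oneTo n = map suc (upTo n)

InS : ℕ → List ℕ → Set
InS n σ = σ ↭ oneTo n

revMap : List ℕ → List ℕ
revMap = reverse

compMap : List ℕ → List ℕ
compMap σ = map (λ v → suc (length σ) ∸ v) σ

countB : (ℕ → Bool) → List ℕ → ℕ
countB p []       = 0
countB p (x ∷ xs) = (if p x then 1 else 0) + countB p xs

majAux : ℕ → List ℕ → ℕ
majAux i (a ∷ b ∷ rest) = (if b <ᵇ a then i else 0) + majAux (suc i) (b ∷ rest)
majAux i _              = 0

maj : List ℕ → ℕ
maj = majAux 1

posAux : ℕ → ℕ → List ℕ → ℕ
posAux i v []       = 0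
posAux i v (x ∷ xs) = if x ≡ᵇ v then i else posAux (suc i) v xs

inv : List ℕ → List ℕ
inv σ = map (λ v → posAux 1 v σ) (oneTo (length σ))

load : List ℕ → ℕ
load σ = maj (revMap (inv σ))

imaj : List ℕ → ℕ
imaj σ = maj (inv σ)

-- One pass through the remaining entries, left to right, removing the
-- needed value (starting at `next`) whenever it is encountered.
record PassResult : Set where
  constructor mkPR
  field
    nextNeeded : ℕ
    remaining  : List ℕ

pass : ℕ → List ℕ → PassResult
pass next []       = mkPR next []
pass next (x ∷ xs) with x ≡ᵇ next
... | true  = pass (suc next) xs
... | false = let r = pass next xs in mkPR (PassResult.nextNeeded r) (x ∷ PassResult.remaining r)

-- total over passes of the number of entries not removed in that pass
-- (fuel = number of passes allowed; length σ passes suffice for σ ∈ S_n)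
disorderAux : ℕ → ℕ → List ℕ → ℕ
disorderAux zero       next rem = 0
disorderAux (suc fuel) next []  = 0
disorderAux (suc fuel) next (x ∷ xs) =
  let r = pass next (x ∷ xs)
  in length (PassResult.remaining r)
     + disorderAux fuel (PassResult.nextNeeded r) (PassResult.remaining r)

disorder : List ℕ → ℕ
disorder σ = disorderAux (length σ) 1 σ

invIndex : List ℕ → ℕ
invIndex []       = 0
invIndex (x ∷ xs) = x * countB (λ y → y <ᵇ x) xs + invIndex xs

-- (5) makl: occurrences of 1-32, 31-2, 32-1 plus descents.
-- For each adjacent pair (a , b) = (σ_i , σ_{i+1}), with prefix `pre`
-- (entries before position i) and suffix `rest` (entries after i+1):
--   1-32 with (i2,i3) = (i,i+1):  x in pre,  x < b < a
--   31-2 with (i1,i2) = (i,i+1):  z in rest, b < z < a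
--   32-1 with (i1,i2) = (i,i+1):  z in rest, z < b < a
--   descent:                      b < a
maklAux : List ℕ → List ℕ → ℕ
maklAux pre (a ∷ b ∷ rest) =
  (if b <ᵇ a
     then countB (λ x → x <ᵇ b) pre
          + countB (λ z → if b <ᵇ z then z <ᵇ a else false) rest
          + countB (λ z → z <ᵇ b) rest
          + 1
     else 0)
  + maklAux (pre ++ [ a ]) (b ∷ rest)
maklAux pre _ = 0

makl : List ℕ → ℕ
makl = maklAux []

RHomomesicNotC : (List ℕ → ℕ) → Set
RHomomesicNotC st =
  (∀ n → 1 ≤ n → Homomesic (InS n) revMap (λ σ → + st σ))
  × (∃ λ n → (1 ≤ n) × ¬ Homomesic (InS n) compMap (λ σ → + st σ))

-- The reverse map R is an involution, so its orbits are {σ , R σ} and R-homomesy of a statistic st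
-- on Sₙ amounts to st σ + st (R σ) not depending on σ.
-- For load, imaj and disorder, st σ is a weighted count of the pairs of consecutive values v, v + 1
-- that occur in σ in a prescribed relative order; reversing σ swaps the relative order of every such
-- pair, so the two counts add up to the total weight.
-- Every pair of entries is an inversion of exactly one of σ and R σ, so invIndex σ + invIndex (R σ)
-- is the sum over all pairs of the larger entry. Finally makl σ + makl (R σ) = n (n - 1) / 2, by
-- induction on σ: the first entry of σ, which is the last entry of R σ, adds exactly n - 1 to the sum.
-- For the complement map, the orbits {123 , 321} and {132 , 312} of S₃ have different sums.

module Submission where

open import Defs
open import Data.Bool using (Bool; true; false; if_then_else_; not)
open import Data.Bool.Properties using (T-≡; ¬-not; not-¬)
open import Data.Empty using (⊥-elim)
open import Data.Integer as ℤ using (ℤ)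
import Data.Integer.Properties as ℤ
open import Data.List using (List; []; _∷_; _++_; [_]; _∷ʳ_; length; map; upTo; applyUpTo; reverse; filter)
open import Data.List.Properties using (length-map; length-upTo; map-upTo; unfold-reverse; reverse-map; reverse-involutive; ++-identityʳ; ++-assoc; filter-accept; filter-reject)
open import Data.List.Membership.Propositional using (_∈_; _∉_)
open import Data.List.Relation.Unary.All as All using (All; []; _∷_; tabulate; zipWith)
open import Data.List.Relation.Unary.All.Properties using (All¬⇒¬Any)
open import Data.List.Relation.Unary.Any as Any using (here; there)
open import Data.List.Relation.Unary.Linked as Linked using (Linked; []; [-]; _∷_)
open import Data.List.Relation.Unary.Unique.Propositional using (Unique; []; _∷_)
open import Data.List.Relation.Unary.Unique.Propositional.Properties using (upTo⁺) renaming (map⁺ to Unique-map⁺)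
open import Data.List.Relation.Binary.Permutation.Propositional as ↭ using (_↭_; ↭-refl; ↭-prep; ↭-swap; ↭-sym; ↭-trans; ↭-reflexive; ↭⇒↭ₛ)
open import Data.List.Relation.Binary.Permutation.Propositional.Properties using (∈-resp-↭; ↭-length; ↭-empty-inv; ↭-reverse; filter-↭) renaming (map⁺ to ↭-map⁺)
open import Data.Nat using (ℕ; zero; suc; _+_; _*_; _∸_; _≤_; _<_; _≮_; pred; _≟_; _≤?_; _<ᵇ_; _≡ᵇ_; s≤s; z≤n; z<s)
open import Data.Nat.Properties
open import Data.Nat.ListAction using (sum)
open import Data.Nat.ListAction.Properties using (sum-↭)
open import Data.Nat.Solver using (module +-*-Solver)
open import Data.Product using (_×_; _,_; ∃; proj₁; proj₂; uncurry)
open import Data.Sum as Sum using (_⊎_; inj₁; inj₂)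
open import Function using (id; flip; _∘_; Equivalence)
open import Relation.Binary.Definitions using (tri<; tri≈; tri>)
open import Relation.Binary.PropositionalEquality hiding ([_])
open import Relation.Binary.PropositionalEquality.Properties using (setoid)
open import Relation.Nullary using (¬_; yes; no)
open import Relation.Unary using (Decidable)
open import Data.List.Relation.Binary.Permutation.Setoid.Properties (setoid ℕ) using (Unique-resp-↭)
open import Algebra.Properties.CommutativeSemigroup +-commutativeSemigroup using () renaming (interchange to +-interchange)
open +-*-Solver using (solve; _:+_; _:*_; _:=_; con)

-- Orbits of an involution have one or two elements; on each of them the
-- average of st is c / 2.
homomesic-of-involution : {A : Set} (S : A → Set) (X : A → A) (st : A → ℕ) (c : ℕ) →
  (∀ x → S x → X (X x) ≡ x) → (∀ x → S x → st x + st (X x) ≡ c) →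
  Homomesic S X (λ x → ℤ.+ st x)
homomesic-of-involution S X st c involutive sum≡c = ℤ.+ c , 2 , s≤s z≤n , orbit-average
  where
  orbit-average : ∀ x → S x → ∀ k → OrbitSize X x k →
    ℤ.+ 2 ℤ.* orbitSum (λ y → ℤ.+ st y) X x k ≡ ℤ.+ c ℤ.* ℤ.+ k
  orbit-average x x∈S 0 (() , _)
  orbit-average x x∈S 1 (_ , Xx≡x , _) = begin
    ℤ.+ 2 ℤ.* ℤ.+ st x          ≡⟨ ℤ.pos-* 2 (st x) ⟨
    ℤ.+ (st x + (st x + 0))     ≡⟨ cong (λ y → ℤ.+ (st x + y)) (+-identityʳ (st x)) ⟩
    ℤ.+ (st x + st x)           ≡⟨ cong (λ y → ℤ.+ (st x + st y)) Xx≡x ⟨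
    ℤ.+ (st x + st (X x))       ≡⟨ cong ℤ.+_ (sum≡c x x∈S) ⟩
    ℤ.+ c                       ≡⟨ cong ℤ.+_ (*-identityʳ c) ⟨
    ℤ.+ (c * 1)                 ≡⟨ ℤ.pos-* c 1 ⟩
    ℤ.+ c ℤ.* ℤ.+ 1             ∎
    where open ≡-Reasoning
  orbit-average x x∈S 2 _ = begin
    ℤ.+ 2 ℤ.* (ℤ.+ st x ℤ.+ ℤ.+ st (X x))  ≡⟨ cong (ℤ.+ 2 ℤ.*_) (ℤ.pos-+ (st x) (st (X x))) ⟨
    ℤ.+ 2 ℤ.* ℤ.+ (st x + st (X x))        ≡⟨ cong (λ y → ℤ.+ 2 ℤ.* ℤ.+ y) (sum≡c x x∈S) ⟩
    ℤ.+ 2 ℤ.* ℤ.+ c                        ≡⟨ ℤ.*-comm (ℤ.+ 2) (ℤ.+ c) ⟩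
    ℤ.+ c ℤ.* ℤ.+ 2                        ∎
    where open ≡-Reasoning
  orbit-average x x∈S (suc (suc (suc k))) (_ , _ , not-fixed) =
    ⊥-elim (not-fixed 2 (s≤s z≤n) (s≤s (s≤s (s≤s z≤n))) (involutive x x∈S))

¬homomesic-of-unequal-orbitSums : {A : Set} {S : A → Set} {X : A → A} {f : A → ℤ} {x y : A} {k : ℕ} →
  S x → S y → OrbitSize X x k → OrbitSize X y k →
  orbitSum f X x k ≢ orbitSum f X y k → ¬ Homomesic S X f
¬homomesic-of-unequal-orbitSums x∈S y∈S |x| |y| sums≢ (p , suc q , _ , average) =
  sums≢ (ℤ.*-cancelˡ-≡ (ℤ.+ suc q) _ _ (trans (average _ x∈S _ |x|) (sym (average _ y∈S _ |y|))))

orbitSize-two : {A : Set} {X : A → A} {x : A} → X x ≢ x → X (X x) ≡ x → OrbitSize X x 2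
orbitSize-two Xx≢x XXx≡x = s≤s z≤n , XXx≡x , λ { 1 _ _ → Xx≢x ; (suc (suc _)) _ (s≤s (s≤s ())) }

≡⇒≡ᵇ≡true : ∀ {m n} → m ≡ n → (m ≡ᵇ n) ≡ true
≡⇒≡ᵇ≡true {m} {n} m≡n = Equivalence.to T-≡ (≡⇒≡ᵇ m n m≡n)

≡ᵇ≡true⇒≡ : ∀ {m n} → (m ≡ᵇ n) ≡ true → m ≡ n
≡ᵇ≡true⇒≡ {m} {n} e = ≡ᵇ⇒≡ m n (Equivalence.from T-≡ e)

≢⇒≡ᵇ≡false : ∀ {m n} → m ≢ n → (m ≡ᵇ n) ≡ false
≢⇒≡ᵇ≡false m≢n = ¬-not (m≢n ∘ ≡ᵇ≡true⇒≡)

≡ᵇ≡false⇒≢ : ∀ {m n} → (m ≡ᵇ n) ≡ false → m ≢ n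
≡ᵇ≡false⇒≢ e m≡n = not-¬ e (≡⇒≡ᵇ≡true m≡n)

<⇒<ᵇ≡true : ∀ {m n} → m < n → (m <ᵇ n) ≡ true
<⇒<ᵇ≡true m<n = Equivalence.to T-≡ (<⇒<ᵇ m<n)

≮⇒<ᵇ≡false : ∀ {m n} → m ≮ n → (m <ᵇ n) ≡ false
≮⇒<ᵇ≡false {m} {n} m≮n = ¬-not (m≮n ∘ <ᵇ⇒< m n ∘ Equivalence.from T-≡)

∈-tail : ∀ {x a : ℕ} {xs} → x ≢ a → a ∈ x ∷ xs → a ∈ xs
∈-tail x≢a = Any.tail (x≢a ∘ sym)

Unique-oneTo : ∀ n → Unique (oneTo n)
Unique-oneTo n = Unique-map⁺ suc-injective (upTo⁺ n)

↭-Unique : ∀ {xs ys : List ℕ} → xs ↭ ys → Unique ys → Unique xs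
↭-Unique xs↭ys = Unique-resp-↭ (↭⇒↭ₛ (↭-sym xs↭ys))

↭⇒All∈ : ∀ {xs ys : List ℕ} → xs ↭ ys → All (_∈ ys) xs
↭⇒All∈ xs↭ys = tabulate (∈-resp-↭ xs↭ys)

InS⇒length : ∀ {n σ} → InS n σ → length σ ≡ n
InS⇒length {n} σ↭ = trans (↭-length σ↭) (trans (length-map suc (upTo n)) (length-upTo n))

InS⇒Unique : ∀ {n σ} → InS n σ → Unique σ
InS⇒Unique {n} σ↭ = ↭-Unique σ↭ (Unique-oneTo n)

InS-reverse : ∀ {n σ} → InS n σ → InS n (reverse σ)
InS-reverse {σ = σ} σ↭ = ↭-trans (↭-reverse σ) σ↭

-- Relative order of two entries

before : List ℕ → ℕ → ℕ → Bool
before []       a b = false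
before (x ∷ xs) a b = if x ≡ᵇ a then true else if x ≡ᵇ b then false else before xs a b

before-skip : ∀ {x a b} xs → x ≢ a → x ≢ b → before (x ∷ xs) a b ≡ before xs a b
before-skip xs x≢a x≢b rewrite ≢⇒≡ᵇ≡false x≢a | ≢⇒≡ᵇ≡false x≢b = refl

before-++ : ∀ {a b} xs ys → a ∈ xs ⊎ b ∈ xs → before (xs ++ ys) a b ≡ before xs a b
before-++ [] ys (inj₁ ())
before-++ [] ys (inj₂ ())
before-++ {a} {b} (x ∷ xs) ys a∈⊎b∈ with x ≡ᵇ a in x≟a
... | true = refl
... | false with x ≡ᵇ b in x≟b
...   | true = refl
...   | false = before-++ xs ys (Sum.map (∈-tail (≡ᵇ≡false⇒≢ x≟a)) (∈-tail (≡ᵇ≡false⇒≢ x≟b)) a∈⊎b∈)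

before-∉ : ∀ {a b} xs → a ∉ xs → before xs a b ≡ false
before-∉ [] a∉ = refl
before-∉ {a} {b} (x ∷ xs) a∉ with x ≡ᵇ a in x≟a
... | true = ⊥-elim (a∉ (here (sym (≡ᵇ≡true⇒≡ x≟a))))
... | false with x ≡ᵇ b
...   | true = refl
...   | false = before-∉ xs (a∉ ∘ there)

before-∈-∉ : ∀ {a b} xs → a ∈ xs → b ∉ xs → before xs a b ≡ true
before-∈-∉ {a} {b} (x ∷ xs) a∈ b∉ with x ≡ᵇ a in x≟a
... | true = refl
... | false with x ≡ᵇ b in x≟b
...   | true = ⊥-elim (b∉ (here (sym (≡ᵇ≡true⇒≡ x≟b))))
...   | false = before-∈-∉ xs (∈-tail (≡ᵇ≡false⇒≢ x≟a) a∈) (b∉ ∘ there)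

before-not : ∀ {a b} xs → a ∈ xs → a ≢ b → before xs a b ≡ not (before xs b a)
before-not {a} {b} (x ∷ xs) a∈ a≢b with x ≡ᵇ a in x≟a | x ≡ᵇ b in x≟b
... | true  | true  = ⊥-elim (a≢b (trans (sym (≡ᵇ≡true⇒≡ {x} x≟a)) (≡ᵇ≡true⇒≡ {x} x≟b)))
... | true  | false = refl
... | false | true  = refl
... | false | false = before-not xs (∈-tail (≡ᵇ≡false⇒≢ x≟a) a∈) a≢b

before-reverse : ∀ {a b} xs → Unique xs → a ∈ xs → b ∈ xs → a ≢ b → before (reverse xs) a b ≡ before xs b a
before-reverse {a} {b} (x ∷ xs) (x∉xs ∷ xs!) a∈ b∈ a≢b
  rewrite unfold-reverse x xs with x ≡ᵇ b in x≟b
... | true = trans (before-++ (reverse xs) [ x ] (inj₁ a∈rev)) (before-∈-∉ (reverse xs) a∈rev b∉rev)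
  where
  x≡b = ≡ᵇ≡true⇒≡ x≟b
  a∈rev = ∈-resp-↭ (↭-sym (↭-reverse xs)) (∈-tail (λ x≡a → a≢b (trans (sym x≡a) x≡b)) a∈)
  b∉rev = λ b∈rev → All¬⇒¬Any x∉xs (subst (_∈ xs) (sym x≡b) (∈-resp-↭ (↭-reverse xs) b∈rev))
... | false with x ≡ᵇ a in x≟a
...   | true = trans (before-++ (reverse xs) [ x ] (inj₂ b∈rev)) (before-∉ (reverse xs) a∉rev)
  where
  b∈rev = ∈-resp-↭ (↭-sym (↭-reverse xs)) (∈-tail (≡ᵇ≡false⇒≢ x≟b) b∈)
  a∉rev = λ a∈rev → All¬⇒¬Any x∉xs (subst (_∈ xs) (sym (≡ᵇ≡true⇒≡ x≟a)) (∈-resp-↭ (↭-reverse xs) a∈rev))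
...   | false = trans (before-++ (reverse xs) [ x ] (inj₁ (∈-resp-↭ (↭-sym (↭-reverse xs)) a∈xs)))
                      (before-reverse xs xs! a∈xs (∈-tail (≡ᵇ≡false⇒≢ x≟b) b∈) a≢b)
  where a∈xs = ∈-tail (≡ᵇ≡false⇒≢ x≟a) a∈

posAux-≥ : ∀ i a σ → a ∈ σ → i ≤ posAux i a σ
posAux-≥ i a (x ∷ σ) a∈ with x ≡ᵇ a in x≟a
... | true = ≤-refl
... | false = ≤-trans (n≤1+n i) (posAux-≥ (suc i) a σ (∈-tail (≡ᵇ≡false⇒≢ x≟a) a∈))

posAux-<ᵇ : ∀ i {a b} σ → a ∈ σ → b ∈ σ → a ≢ b → (posAux i b σ <ᵇ posAux i a σ) ≡ before σ b a
posAux-<ᵇ i {a} {b} (x ∷ σ) a∈ b∈ a≢b with x ≡ᵇ b in x≟b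
... | true rewrite ≢⇒≡ᵇ≡false {x} {a} (λ x≡a → a≢b (trans (sym x≡a) (≡ᵇ≡true⇒≡ x≟b))) =
  <⇒<ᵇ≡true (posAux-≥ (suc i) a σ (∈-tail (λ x≡a → a≢b (trans (sym x≡a) (≡ᵇ≡true⇒≡ x≟b))) a∈))
... | false with x ≡ᵇ a in x≟a
...   | true = ≮⇒<ᵇ≡false (λ lt → <-irrefl refl
                   (<-trans lt (posAux-≥ (suc i) b σ (∈-tail (≡ᵇ≡false⇒≢ x≟b) b∈))))
...   | false = posAux-<ᵇ (suc i) σ (∈-tail (≡ᵇ≡false⇒≢ x≟a) a∈) (∈-tail (≡ᵇ≡false⇒≢ x≟b) b∈) a≢b

before-filter : ∀ {P : ℕ → Set} (P? : Decidable P) {a b} xs → P a → P b → before (filter P? xs) a b ≡ before xs a b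
before-filter P? [] Pa Pb = refl
before-filter {P} P? {a} {b} (x ∷ xs) Pa Pb with P? x
... | no ¬Px = trans (before-filter P? xs Pa Pb) (sym (before-skip xs (¬P-≢ Pa) (¬P-≢ Pb)))
  where ¬P-≢ : ∀ {y} → P y → x ≢ y
        ¬P-≢ Py x≡y = ¬Px (subst P (sym x≡y) Py)
... | yes _ with x ≡ᵇ a
...   | true = refl
...   | false with x ≡ᵇ b
...     | true = refl
...     | false = before-filter P? xs Pa Pb

-- Load and inverse major index

weightedPairCount : (ℕ → ℕ) → (ℕ → ℕ → Bool) → ℕ → List ℕ → ℕ
weightedPairCount w P i (a ∷ b ∷ rest) = (if P a b then w i else 0) + weightedPairCount w P (suc i) (b ∷ rest)
weightedPairCount w P i _              = 0

weightedPairCount-cong : ∀ w {P Q} i {L} → Linked (λ a b → P a b ≡ Q a b) L →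
  weightedPairCount w P i L ≡ weightedPairCount w Q i L
weightedPairCount-cong w i []  = refl
weightedPairCount-cong w i [-] = refl
weightedPairCount-cong w i (Pab≡Qab ∷ rest) =
  cong₂ _+_ (cong (λ t → if t then w i else 0) Pab≡Qab) (weightedPairCount-cong w (suc i) rest)

weightedPairCount-complement : ∀ w {P Q} i {L} → Linked (λ a b → P a b ≡ not (Q a b)) L →
  weightedPairCount w P i L + weightedPairCount w Q i L ≡ weightedPairCount w (λ _ _ → true) i L
weightedPairCount-complement w i []  = refl
weightedPairCount-complement w i [-] = refl
weightedPairCount-complement w {P} {Q} i {a ∷ b ∷ _} (Pab≡¬Qab ∷ rest) =
  trans (+-interchange (if P a b then w i else 0) _ (if Q a b then w i else 0) _)
        (cong₂ _+_ (split (P a b) (Q a b) Pab≡¬Qab) (weightedPairCount-complement w (suc i) rest))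
  where
  split : ∀ p q → p ≡ not q → (if p then w i else 0) + (if q then w i else 0) ≡ w i
  split false true  refl = refl
  split true  false refl = +-identityʳ (w i)

majAux-map : ∀ (f : ℕ → ℕ) i L → majAux i (map f L) ≡ weightedPairCount id (λ a b → f b <ᵇ f a) i L
majAux-map f i []           = refl
majAux-map f i (a ∷ [])     = refl
majAux-map f i (a ∷ b ∷ L) = cong ((if f b <ᵇ f a then i else 0) +_) (majAux-map f (suc i) (b ∷ L))

Linked-distinct-∈ : ∀ {σ L : List ℕ} → Unique L → All (_∈ σ) L → Linked (λ a b → a ∈ σ × b ∈ σ × a ≢ b) L
Linked-distinct-∈ [] [] = []
Linked-distinct-∈ (_ ∷ []) (_ ∷ []) = [-]
Linked-distinct-∈ ((a≢b ∷ _) ∷ L!) (a∈ ∷ b∈ ∷ L⊆) = (a∈ , b∈ , a≢b) ∷ Linked-distinct-∈ L! (b∈ ∷ L⊆)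

weightedPairCount-reverse : ∀ w i {L σ} → Unique σ → Unique L → All (_∈ σ) L →
  weightedPairCount w (flip (before σ)) i L + weightedPairCount w (flip (before (reverse σ))) i L
    ≡ weightedPairCount w (λ _ _ → true) i L
weightedPairCount-reverse w i {L} {σ} σ! L! L⊆σ = weightedPairCount-complement w i
  (Linked.map (λ { (a∈ , b∈ , a≢b) →
     trans (before-not σ b∈ (a≢b ∘ sym)) (cong not (sym (before-reverse σ σ! b∈ a∈ (a≢b ∘ sym)))) })
   (Linked-distinct-∈ L! L⊆σ))

majAux-positions : ∀ i {L σ} → Unique L → All (_∈ σ) L →
  majAux i (map (λ v → posAux 1 v σ) L) ≡ weightedPairCount id (flip (before σ)) i L
majAux-positions i {L} {σ} L! L⊆σ = trans (majAux-map (λ v → posAux 1 v σ) i L)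
  (weightedPairCount-cong id i (Linked.map (λ { (a∈ , b∈ , a≢b) → posAux-<ᵇ 1 σ a∈ b∈ a≢b })
                                           (Linked-distinct-∈ L! L⊆σ)))

reverse-sum-by-weightedPairCount : ∀ {n} (st : List ℕ → ℕ) w {L} → L ↭ oneTo n →
  (∀ {σ} → InS n σ → st σ ≡ weightedPairCount w (flip (before σ)) 1 L) →
  ∀ σ → InS n σ → st σ + st (reverse σ) ≡ weightedPairCount w (λ _ _ → true) 1 L
reverse-sum-by-weightedPairCount {n} st w L↭ st≡ σ σ∈Sₙ =
  trans (cong₂ _+_ (st≡ σ∈Sₙ) (st≡ (InS-reverse σ∈Sₙ)))
        (weightedPairCount-reverse w 1 (InS⇒Unique σ∈Sₙ) (InS⇒Unique L↭) (↭⇒All∈ (↭-trans L↭ (↭-sym σ∈Sₙ))))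

imaj≡weightedPairCount : ∀ {n σ} → InS n σ → imaj σ ≡ weightedPairCount id (flip (before σ)) 1 (oneTo n)
imaj≡weightedPairCount {n} σ∈Sₙ rewrite InS⇒length σ∈Sₙ =
  majAux-positions 1 (Unique-oneTo n) (↭⇒All∈ (↭-sym σ∈Sₙ))

load≡weightedPairCount : ∀ {n σ} → InS n σ → load σ ≡ weightedPairCount id (flip (before σ)) 1 (reverse (oneTo n))
load≡weightedPairCount {n} {σ} σ∈Sₙ rewrite InS⇒length σ∈Sₙ | sym (reverse-map (λ v → posAux 1 v σ) (oneTo n)) =
  majAux-positions 1 (InS⇒Unique (↭-reverse (oneTo n))) (↭⇒All∈ (↭-trans (↭-reverse (oneTo n)) (↭-sym σ∈Sₙ)))

imaj-reverse-sum : ∀ n σ → InS n σ → imaj σ + imaj (reverse σ) ≡ weightedPairCount id (λ _ _ → true) 1 (oneTo n)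
imaj-reverse-sum n = reverse-sum-by-weightedPairCount imaj id ↭-refl imaj≡weightedPairCount

load-reverse-sum : ∀ n σ → InS n σ → load σ + load (reverse σ) ≡ weightedPairCount id (λ _ _ → true) 1 (reverse (oneTo n))
load-reverse-sum n = reverse-sum-by-weightedPairCount load id (↭-reverse (oneTo n)) load≡weightedPairCount

-- Disorder

range : ℕ → ℕ → List ℕ
range k zero    = []
range k (suc c) = k ∷ range (suc k) c

∈-range⁻ : ∀ {y} k c → y ∈ range k c → k ≤ y × y < k + c
∈-range⁻ k (suc c) (here refl) = ≤-refl , m<m+n k z<s
∈-range⁻ {y} k (suc c) (there y∈) with ∈-range⁻ (suc k) c y∈
... | k<y , y<1+k+c = <⇒≤ k<y , subst (y <_) (sym (+-suc k c)) y<1+k+c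

∈-range⁺ : ∀ {y} k c → k ≤ y → y < k + c → y ∈ range k c
∈-range⁺ {y} k zero k≤y y<k+0 = ⊥-elim (≤⇒≯ k≤y (subst (y <_) (+-identityʳ k) y<k+0))
∈-range⁺ {y} k (suc c) k≤y y<k+1+c with k ≟ y
... | yes refl = here refl
... | no k≢y = there (∈-range⁺ (suc k) c (≤∧≢⇒< k≤y k≢y) (subst (y <_) (+-suc k c) y<k+1+c))

Unique-range : ∀ k c → Unique (range k c)
Unique-range k zero    = []
Unique-range k (suc c) =
  tabulate (λ k∈ k≡ → <-irrefl k≡ (proj₁ (∈-range⁻ (suc k) c k∈))) ∷ Unique-range (suc k) c

length-range : ∀ k c → length (range k c) ≡ c
length-range k zero    = refl
length-range k (suc c) = cong suc (length-range (suc k) c)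

Linked-range : ∀ {R : ℕ → ℕ → Set} k c → (∀ {v} → k ≤ v → R v (suc v)) → Linked R (range k c)
Linked-range k zero          R-step = []
Linked-range k (suc zero)    R-step = [-]
Linked-range k (suc (suc c)) R-step = R-step ≤-refl ∷ Linked-range (suc k) (suc c) (R-step ∘ ≤-trans (n≤1+n k))

applyUpTo-range : ∀ (f : ℕ → ℕ) k n → (∀ i → f i ≡ k + i) → applyUpTo f n ≡ range k n
applyUpTo-range f k zero    f≡ = refl
applyUpTo-range f k (suc n) f≡ =
  cong₂ _∷_ (trans (f≡ 0) (+-identityʳ k))
    (applyUpTo-range (λ i → f (suc i)) (suc k) n (λ i → trans (f≡ (suc i)) (+-suc k i)))

oneTo≡range : ∀ n → oneTo n ≡ range 1 n
oneTo≡range n = trans (map-upTo suc n) (applyUpTo-range suc 1 n (λ _ → refl))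

filter-range-≥ : ∀ {m} k c → m ≤ k → filter (m ≤?_) (range k c) ≡ range k c
filter-range-≥ k zero    m≤k = refl
filter-range-≥ k (suc c) m≤k =
  trans (filter-accept (_ ≤?_) m≤k) (cong (k ∷_) (filter-range-≥ (suc k) c (≤-trans m≤k (n≤1+n k))))

filter-range : ∀ {m c′} k c → k ≤ m → k + c ≡ m + c′ → filter (m ≤?_) (range k c) ≡ range m c′
filter-range {m} {zero}   k zero    k≤m k+0≡ = refl
filter-range {m} {suc c′} k zero    k≤m k+0≡ =
  ⊥-elim (≤⇒≯ k≤m (subst (m <_) (trans (sym k+0≡) (+-identityʳ k)) (m<m+n m z<s)))
filter-range {m} k (suc c) k≤m k+1+c≡ with k ≟ m
... | no k≢m = trans (filter-reject (m ≤?_) (<⇒≱ (≤∧≢⇒< k≤m k≢m)))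
                     (filter-range (suc k) c (≤∧≢⇒< k≤m k≢m) (trans (sym (+-suc k c)) k+1+c≡))
... | yes refl rewrite sym (+-cancelˡ-≡ k (suc c) _ k+1+c≡) = filter-range-≥ k (suc c) ≤-refl

-- One pass through xs, looking for the values k, k+1, …, stops needing m and leaves r.
record PassInvariant (k : ℕ) (xs : List ℕ) (m : ℕ) (r : List ℕ) : Set where
  field
    start≤next       : k ≤ m
    remaining≡filter : r ≡ filter (m ≤?_) xs
    removed∈         : ∀ {y} → k ≤ y → y < m → y ∈ xs
    removed-in-order : ∀ {v} → k ≤ v → suc v < m → before xs (suc v) v ≡ false
    next-out-of-order : k < m → m ∈ xs → before xs m (pred m) ≡ true
    start-removed    : k ∈ xs → k < m

PassInvariant-removed : ∀ {k xs m r} → All (k ≢_) xs → PassInvariant (suc k) xs m r → PassInvariant k (k ∷ xs) m r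
PassInvariant-removed {k} {xs} {m} k∉xs inv = record
  { start≤next       = <⇒≤ start≤next
  ; remaining≡filter = trans remaining≡filter (sym (filter-reject (m ≤?_) (<⇒≱ start≤next)))
  ; removed∈         = removed∈′
  ; removed-in-order = removed-in-order′
  ; next-out-of-order = next-out-of-order′
  ; start-removed    = λ _ → start≤next
  }
  where
  open PassInvariant inv
  removed∈′ : ∀ {y} → k ≤ y → y < m → y ∈ k ∷ xs
  removed∈′ {y} k≤y y<m with k ≟ y
  ... | yes refl = here refl
  ... | no k≢y = there (removed∈ (≤∧≢⇒< k≤y k≢y) y<m)
  removed-in-order′ : ∀ {v} → k ≤ v → suc v < m → before (k ∷ xs) (suc v) v ≡ false
  removed-in-order′ {v} k≤v 1+v<m with k ≟ v
  ... | yes refl rewrite ≢⇒≡ᵇ≡false (<⇒≢ (n<1+n k)) | ≡⇒≡ᵇ≡true {k} refl = refl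
  ... | no k≢v = trans (before-skip xs (<⇒≢ (s≤s k≤v)) k≢v) (removed-in-order (≤∧≢⇒< k≤v k≢v) 1+v<m)
  next-out-of-order′ : k < m → m ∈ k ∷ xs → before (k ∷ xs) m (pred m) ≡ true
  next-out-of-order′ k<m m∈ with suc k ≟ m
  ... | yes refl = ⊥-elim (<-irrefl refl (start-removed (∈-tail (<⇒≢ (n<1+n k)) m∈)))
  ... | no 1+k≢m = trans (before-skip xs (<⇒≢ k<m) (<⇒≢ (<⇒≤pred 1+k<m)))
                         (next-out-of-order 1+k<m (∈-tail (<⇒≢ k<m) m∈))
    where 1+k<m = ≤∧≢⇒< start≤next 1+k≢m

PassInvariant-kept : ∀ {k x xs m r} → x ≢ k → k ≤ x → All (x ≢_) xs → PassInvariant k xs m r →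
  PassInvariant k (x ∷ xs) m (x ∷ r)
PassInvariant-kept {k} {x} {xs} {m} x≢k k≤x x∉xs inv = record
  { start≤next       = start≤next
  ; remaining≡filter = trans (cong (x ∷_) remaining≡filter) (sym (filter-accept (m ≤?_) m≤x))
  ; removed∈         = λ k≤y y<m → there (removed∈ k≤y y<m)
  ; removed-in-order = λ k≤v 1+v<m →
      trans (before-skip xs (>⇒≢ (<-≤-trans 1+v<m m≤x)) (>⇒≢ (<-≤-trans (<-trans (n<1+n _) 1+v<m) m≤x)))
            (removed-in-order k≤v 1+v<m)
  ; next-out-of-order = next-out-of-order′
  ; start-removed    = start-removed ∘ ∈-tail x≢k
  }
  where
  open PassInvariant inv
  m≤x : m ≤ x
  m≤x = ≮⇒≥ (λ x<m → All¬⇒¬Any x∉xs (removed∈ k≤x x<m))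
  next-out-of-order′ : k < m → m ∈ x ∷ xs → before (x ∷ xs) m (pred m) ≡ true
  next-out-of-order′ k<m m∈ with x ≟ m
  ... | yes x≡m rewrite ≡⇒≡ᵇ≡true x≡m = refl
  ... | no x≢m = trans (before-skip xs x≢m (>⇒≢ (<-≤-trans (pred< k<m) m≤x)))
                       (next-out-of-order k<m (∈-tail x≢m m∈))
    where pred< : ∀ {k m} → k < m → pred m < m
          pred< (s≤s _) = ≤-refl

pass-invariant : ∀ k xs → Unique xs → All (k ≤_) xs →
  PassInvariant k xs (PassResult.nextNeeded (pass k xs)) (PassResult.remaining (pass k xs))
pass-invariant k [] [] [] = record
  { start≤next       = ≤-refl
  ; remaining≡filter = refl
  ; removed∈         = λ k≤y y<k → ⊥-elim (≤⇒≯ k≤y y<k)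
  ; removed-in-order = λ k≤v 1+v<k → ⊥-elim (≤⇒≯ k≤v (<-trans (n<1+n _) 1+v<k))
  ; next-out-of-order = λ k<k → ⊥-elim (<-irrefl refl k<k)
  ; start-removed    = λ ()
  }
pass-invariant k (x ∷ xs) (x∉xs ∷ xs!) (k≤x ∷ k≤xs) with x ≡ᵇ k in x≟k
... | true with refl ← ≡ᵇ≡true⇒≡ {x} x≟k =
  PassInvariant-removed x∉xs (pass-invariant (suc k) xs xs! (zipWith (uncurry ≤∧≢⇒<) (k≤xs , x∉xs)))
... | false = PassInvariant-kept (≡ᵇ≡false⇒≢ x≟k) k≤x x∉xs (pass-invariant k xs xs! k≤xs)

weightedPairCount-range-false : ∀ w P k c → P k (suc k) ≡ false →
  weightedPairCount w P k (range k (suc c)) ≡ weightedPairCount w P (suc k) (range (suc k) c)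
weightedPairCount-range-false w P k zero    _        = refl
weightedPairCount-range-false w P k (suc c) Pk≡false rewrite Pk≡false = refl

weightedPairCount-range-skip : ∀ w P j k c → (∀ {v} → k ≤ v → v < k + j → P v (suc v) ≡ false) →
  weightedPairCount w P k (range k (j + c)) ≡ weightedPairCount w P (k + j) (range (k + j) c)
weightedPairCount-range-skip w P zero    k c _ rewrite +-identityʳ k = refl
weightedPairCount-range-skip w P (suc j) k c P≡false = begin
  weightedPairCount w P k (range k (suc j + c))
    ≡⟨ weightedPairCount-range-false w P k (j + c) (P≡false ≤-refl (m<m+n k z<s)) ⟩
  weightedPairCount w P (suc k) (range (suc k) (j + c))
    ≡⟨ weightedPairCount-range-skip w P j (suc k) c
         (λ {v} 1+k≤v v<1+k+j → P≡false (≤-trans (n≤1+n k) 1+k≤v) (subst (v <_) (sym (+-suc k j)) v<1+k+j)) ⟩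
  weightedPairCount w P (suc k + j) (range (suc k + j) c)
    ≡⟨ cong (λ i → weightedPairCount w P i (range i c)) (sym (+-suc k j)) ⟩
  weightedPairCount w P (k + suc j) (range (k + suc j) c) ∎
  where open ≡-Reasoning

pass-bounds : ∀ {k c ys m r} → ys ↭ range k (suc c) → PassInvariant k ys m r → k < m × m ≤ k + suc c
pass-bounds {k} {c} {ys} {suc pm} ys↭ inv = k<m , proj₂ (∈-range⁻ k (suc c) (∈-resp-↭ ys↭ pm∈ys))
  where
  open PassInvariant inv
  k<m = start-removed (∈-resp-↭ (↭-sym ys↭) (here refl))
  pm∈ys = removed∈ (≤-pred k<m) ≤-refl
pass-bounds {m = zero} ys↭ inv = ⊥-elim (≤⇒≯ z≤n (PassInvariant.start-removed inv (∈-resp-↭ (↭-sym ys↭) (here refl))))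

pass-remaining : ∀ {k c ys m c′ r} → ys ↭ range k c → PassInvariant k ys m r → m + c′ ≡ k + c → r ↭ range m c′
pass-remaining {k} {c} {ys} {m} ys↭ inv m+c′≡ rewrite PassInvariant.remaining≡filter inv =
  ↭-trans (filter-↭ (m ≤?_) ys↭) (↭-reflexive (filter-range k c (PassInvariant.start≤next inv) (sym m+c′≡)))

weightedPairCount-range-true : ∀ w P k c → (0 < c → P k (suc k) ≡ true) → w k ≡ c →
  weightedPairCount w P k (range k (suc c)) ≡ c + weightedPairCount w P (suc k) (range (suc k) c)
weightedPairCount-range-true w P k zero    _  _    = refl
weightedPairCount-range-true w P k (suc c) Pk wk≡c rewrite Pk z<s | wk≡c = refl

-- After a pass that stops needing k + j + 1, the values k, …, k + j - 1 contribute nothing,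
-- the pair (k + j , k + j + 1) contributes c′ (if c′ > 0), and the rest is read off r.
weightedPairCount-pass : ∀ N {k j c′ ys r} → ys ↭ range k (j + suc c′) → PassInvariant k ys (suc (k + j)) r →
  N ∸ (k + j) ≡ c′ →
  weightedPairCount (N ∸_) (flip (before ys)) k (range k (j + suc c′))
    ≡ c′ + weightedPairCount (N ∸_) (flip (before r)) (suc (k + j)) (range (suc (k + j)) c′)
weightedPairCount-pass N {k} {j} {c′} {ys} {r} ys↭ inv N∸k+j≡c′ = begin
  weightedPairCount (N ∸_) (flip (before ys)) k (range k (j + suc c′))
    ≡⟨ weightedPairCount-range-skip (N ∸_) _ j k (suc c′) (λ k≤v v<k+j → removed-in-order k≤v (s≤s v<k+j)) ⟩
  weightedPairCount (N ∸_) (flip (before ys)) (k + j) (range (k + j) (suc c′))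
    ≡⟨ weightedPairCount-range-true (N ∸_) _ (k + j) c′
         (λ 0<c′ → next-out-of-order (s≤s (m≤m+n k j)) (next∈ys 0<c′)) N∸k+j≡c′ ⟩
  c′ + weightedPairCount (N ∸_) (flip (before ys)) (suc (k + j)) (range (suc (k + j)) c′)
    ≡⟨ cong (c′ +_) (weightedPairCount-cong (N ∸_) _ (Linked-range _ c′ filtered)) ⟨
  c′ + weightedPairCount (N ∸_) (flip (before r)) (suc (k + j)) (range (suc (k + j)) c′) ∎
  where
  open ≡-Reasoning
  open PassInvariant inv
  next∈ys : 0 < c′ → suc (k + j) ∈ ys
  next∈ys 0<c′ = ∈-resp-↭ (↭-sym ys↭) (∈-range⁺ k (j + suc c′) (≤-trans (m≤m+n k j) (n≤1+n _))
    (subst₂ _<_ (+-comm (k + j) 1) (+-assoc k j (suc c′)) (+-monoʳ-< (k + j) (s≤s 0<c′))))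
  filtered : ∀ {v} → suc (k + j) ≤ v → before r (suc v) v ≡ before ys (suc v) v
  filtered {v} m≤v rewrite remaining≡filter = before-filter (_ ≤?_) ys (≤-trans m≤v (n≤1+n v)) m≤v

disorderAux-[] : ∀ fuel k → disorderAux fuel k [] ≡ 0
disorderAux-[] zero    k = refl
disorderAux-[] (suc _) k = refl

-- N + 1 = k + c is one more than the largest value, so N ∸ v counts the values above v.
disorderAux-range : ∀ N fuel k c {xs} → xs ↭ range k c → c ≤ fuel → suc N ≡ k + c →
  disorderAux fuel k xs ≡ weightedPairCount (N ∸_) (flip (before xs)) k (range k c)
disorderAux-range N fuel    k zero    {xs}     xs↭ _ _ rewrite ↭-empty-inv xs↭ = disorderAux-[] fuel k
disorderAux-range N (suc f) k (suc c) {[]}     xs↭ _ _ with () ← ↭-length xs↭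
disorderAux-range N (suc f) k (suc c) {x ∷ xs} ys↭ (s≤s c≤f) 1+N≡ =
  after-pass (pass-invariant k (x ∷ xs) (↭-Unique ys↭ (Unique-range k (suc c)))
                                         (All.map (proj₁ ∘ ∈-range⁻ k (suc c)) (↭⇒All∈ ys↭)))
  where
  ys = x ∷ xs
  after-pass : ∀ {m r} → PassInvariant k ys m r → length r + disorderAux f m r
    ≡ weightedPairCount (N ∸_) (flip (before ys)) k (range k (suc c))
  after-pass inv with pass-bounds ys↭ inv
  after-pass {zero}          inv | () , _
  after-pass {suc pm} {r} inv | k<m , m≤k+1+c with m≤n⇒∃[o]m+o≡n (≤-pred k<m) | m≤n⇒∃[o]m+o≡n m≤k+1+c
  ... | j , refl | c′ , m+c′≡ = begin
    length r + disorderAux f (suc (k + j)) r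
      ≡⟨ cong₂ _+_ (trans (↭-length r↭) (length-range _ c′))
                   (disorderAux-range N f (suc (k + j)) c′ r↭ c′≤f (trans 1+N≡ (sym m+c′≡))) ⟩
    c′ + weightedPairCount (N ∸_) (flip (before r)) (suc (k + j)) (range (suc (k + j)) c′)
      ≡⟨ weightedPairCount-pass N (subst (λ n → ys ↭ range k n) 1+c≡ ys↭) inv N∸k+j≡c′ ⟨
    weightedPairCount (N ∸_) (flip (before ys)) k (range k (j + suc c′))
      ≡⟨ cong (λ n → weightedPairCount (N ∸_) (flip (before ys)) k (range k n)) 1+c≡ ⟨
    weightedPairCount (N ∸_) (flip (before ys)) k (range k (suc c)) ∎
    where
    open ≡-Reasoning
    r↭ = pass-remaining ys↭ inv m+c′≡
    1+c≡ : suc c ≡ j + suc c′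
    1+c≡ = +-cancelˡ-≡ k _ _ (trans (sym m+c′≡) (trans (sym (+-suc (k + j) c′)) (+-assoc k j (suc c′))))
    c′≤f : c′ ≤ f
    c′≤f = ≤-trans (≤-pred (subst (suc c′ ≤_) (sym 1+c≡) (m≤n+m (suc c′) j))) c≤f
    N∸k+j≡c′ : N ∸ (k + j) ≡ c′
    N∸k+j≡c′ = trans (cong (_∸ (k + j)) (suc-injective (trans 1+N≡ (sym m+c′≡)))) (m+n∸m≡n (k + j) c′)

disorder≡weightedPairCount : ∀ {n σ} → InS n σ → disorder σ ≡ weightedPairCount (n ∸_) (flip (before σ)) 1 (oneTo n)
disorder≡weightedPairCount {n} σ∈Sₙ rewrite InS⇒length σ∈Sₙ | oneTo≡range n =
  disorderAux-range n n 1 n σ∈Sₙ ≤-refl refl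

disorder-reverse-sum : ∀ n σ → InS n σ →
  disorder σ + disorder (reverse σ) ≡ weightedPairCount (n ∸_) (λ _ _ → true) 1 (oneTo n)
disorder-reverse-sum n = reverse-sum-by-weightedPairCount disorder (n ∸_) ↭-refl disorder≡weightedPairCount

-- Inversion index

𝟙 : Bool → ℕ
𝟙 b = if b then 1 else 0

sum-map-↭ : ∀ (f : ℕ → ℕ) {xs ys} → xs ↭ ys → sum (map f xs) ≡ sum (map f ys)
sum-map-↭ f xs↭ys = sum-↭ (↭-map⁺ f xs↭ys)

sum-map-+ : ∀ (f g : ℕ → ℕ) xs → sum (map (λ y → f y + g y) xs) ≡ sum (map f xs) + sum (map g xs)
sum-map-+ f g []       = refl
sum-map-+ f g (x ∷ xs) rewrite sum-map-+ f g xs =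
  +-interchange (f x) (g x) (sum (map f xs)) (sum (map g xs))

countB≡sum : ∀ p xs → countB p xs ≡ sum (map (λ y → 𝟙 (p y)) xs)
countB≡sum p []       = refl
countB≡sum p (x ∷ xs) = cong (𝟙 (p x) +_) (countB≡sum p xs)

*-countB≡sum : ∀ x p xs → x * countB p xs ≡ sum (map (λ y → x * 𝟙 (p y)) xs)
*-countB≡sum x p []       = *-zeroʳ x
*-countB≡sum x p (y ∷ xs) = trans (*-distribˡ-+ x (𝟙 (p y)) _) (cong (x * 𝟙 (p y) +_) (*-countB≡sum x p xs))

countB-↭ : ∀ p {xs ys} → xs ↭ ys → countB p xs ≡ countB p ys
countB-↭ p {xs} {ys} xs↭ys = trans (countB≡sum p xs) (trans (sum-map-↭ _ xs↭ys) (sym (countB≡sum p ys)))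

countB-snoc : ∀ p ys x → countB p (ys ++ [ x ]) ≡ countB p ys + 𝟙 (p x)
countB-snoc p []       x = +-identityʳ _
countB-snoc p (y ∷ ys) x = trans (cong (𝟙 (p y) +_) (countB-snoc p ys x)) (sym (+-assoc (𝟙 (p y)) _ _))

-- For distinct x and y this is their maximum.
larger : ℕ → ℕ → ℕ
larger x y = x * 𝟙 (y <ᵇ x) + y * 𝟙 (x <ᵇ y)

sumOfLarger : List ℕ → ℕ
sumOfLarger []       = 0
sumOfLarger (x ∷ xs) = sum (map (larger x) xs) + sumOfLarger xs

sumOfLarger-↭ : ∀ {xs ys} → xs ↭ ys → sumOfLarger xs ≡ sumOfLarger ys
sumOfLarger-↭ ↭.refl = refl
sumOfLarger-↭ (↭.prep x xs↭ys) = cong₂ _+_ (sum-map-↭ (larger x) xs↭ys) (sumOfLarger-↭ xs↭ys)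
sumOfLarger-↭ (↭.swap {xs} {ys} x y xs↭ys) = begin
  (larger x y + sum (map (larger x) xs)) + (sum (map (larger y) xs) + sumOfLarger xs)
    ≡⟨ cong (λ l → (l + sum (map (larger x) xs)) + (sum (map (larger y) xs) + sumOfLarger xs))
            (+-comm (x * 𝟙 (y <ᵇ x)) _) ⟩
  (larger y x + sum (map (larger x) xs)) + (sum (map (larger y) xs) + sumOfLarger xs)
    ≡⟨ +-interchange (larger y x) (sum (map (larger x) xs)) (sum (map (larger y) xs)) (sumOfLarger xs) ⟩
  (larger y x + sum (map (larger y) xs)) + (sum (map (larger x) xs) + sumOfLarger xs)
    ≡⟨ cong₂ (λ u v → (larger y x + u) + v) (sum-map-↭ (larger y) xs↭ys)
             (cong₂ _+_ (sum-map-↭ (larger x) xs↭ys) (sumOfLarger-↭ xs↭ys)) ⟩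
  (larger y x + sum (map (larger y) ys)) + (sum (map (larger x) ys) + sumOfLarger ys) ∎
  where open ≡-Reasoning
sumOfLarger-↭ (↭.trans xs↭ys ys↭zs) = trans (sumOfLarger-↭ xs↭ys) (sumOfLarger-↭ ys↭zs)

invIndex-snoc : ∀ ys x → invIndex (ys ++ [ x ]) ≡ invIndex ys + sum (map (λ y → y * 𝟙 (x <ᵇ y)) ys)
invIndex-snoc []       x = trans (+-identityʳ (x * 0)) (*-zeroʳ x)
invIndex-snoc (y ∷ ys) x rewrite countB-snoc (_<ᵇ y) ys x | invIndex-snoc ys x =
  solve 5 (λ y c i I S → y :* (c :+ i) :+ (I :+ S) := (y :* c :+ I) :+ (y :* i :+ S)) refl
    y (countB (_<ᵇ y) ys) (𝟙 (x <ᵇ y)) (invIndex ys) (sum (map (λ z → z * 𝟙 (x <ᵇ z)) ys))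

invIndex-+-reverse : ∀ σ → invIndex σ + invIndex (reverse σ) ≡ sumOfLarger σ
invIndex-+-reverse []       = refl
invIndex-+-reverse (x ∷ xs)
  rewrite unfold-reverse x xs | invIndex-snoc (reverse xs) x
        | sum-map-↭ (λ y → y * 𝟙 (x <ᵇ y)) (↭-reverse xs) | *-countB≡sum x (_<ᵇ x) xs =
  trans (solve 4 (λ a i i′ s → (a :+ i) :+ (i′ :+ s) := (a :+ s) :+ (i :+ i′)) refl
             (sum (map (λ y → x * 𝟙 (y <ᵇ x)) xs)) (invIndex xs) (invIndex (reverse xs))
             (sum (map (λ y → y * 𝟙 (x <ᵇ y)) xs)))
    (cong₂ _+_ (sym (sum-map-+ (λ y → x * 𝟙 (y <ᵇ x)) (λ y → y * 𝟙 (x <ᵇ y)) xs)) (invIndex-+-reverse xs))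

invIndex-reverse-sum : ∀ n σ → InS n σ → invIndex σ + invIndex (reverse σ) ≡ sumOfLarger (oneTo n)
invIndex-reverse-sum n σ σ∈Sₙ = trans (invIndex-+-reverse σ) (sumOfLarger-↭ σ∈Sₙ)

-- makl

adjacentSum : (ℕ → ℕ → ℕ) → List ℕ → ℕ
adjacentSum g (a ∷ b ∷ rest) = g a b + adjacentSum g (b ∷ rest)
adjacentSum g _              = 0

adjacentSum-cong : ∀ {g h L} → Linked (λ a b → g a b ≡ h a b) L → adjacentSum g L ≡ adjacentSum h L
adjacentSum-cong []                = refl
adjacentSum-cong [-]               = refl
adjacentSum-cong (gab≡hab ∷ rest) = cong₂ _+_ gab≡hab (adjacentSum-cong rest)

adjacentSum-+ : ∀ g h L → adjacentSum (λ a b → g a b + h a b) L ≡ adjacentSum g L + adjacentSum h L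
adjacentSum-+ g h []          = refl
adjacentSum-+ g h (a ∷ [])    = refl
adjacentSum-+ g h (a ∷ b ∷ L) rewrite adjacentSum-+ g h (b ∷ L) =
  +-interchange (g a b) (h a b) _ _

adjacentSum-∷ʳ : ∀ g L a b → adjacentSum g (L ∷ʳ a ∷ʳ b) ≡ adjacentSum g (L ∷ʳ a) + g a b
adjacentSum-∷ʳ g []           a b = +-comm (g a b) 0
adjacentSum-∷ʳ g (x ∷ [])     a b = trans (cong (g x a +_) (adjacentSum-∷ʳ g [] a b)) (sym (+-assoc (g x a) 0 (g a b)))
adjacentSum-∷ʳ g (x ∷ y ∷ L) a b = trans (cong (g x y +_) (adjacentSum-∷ʳ g (y ∷ L) a b)) (sym (+-assoc (g x y) _ (g a b)))

adjacentSum-reverse : ∀ g L → adjacentSum g (reverse L) ≡ adjacentSum (flip g) L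
adjacentSum-reverse g []          = refl
adjacentSum-reverse g (a ∷ [])    = refl
adjacentSum-reverse g (a ∷ b ∷ L) = begin
  adjacentSum g (reverse (a ∷ b ∷ L))
    ≡⟨ cong (adjacentSum g) (trans (unfold-reverse a (b ∷ L)) (cong (_∷ʳ a) (unfold-reverse b L))) ⟩
  adjacentSum g (reverse L ∷ʳ b ∷ʳ a)     ≡⟨ adjacentSum-∷ʳ g (reverse L) b a ⟩
  adjacentSum g (reverse L ∷ʳ b) + g b a  ≡⟨ cong (λ s → adjacentSum g s + g b a) (unfold-reverse b L) ⟨
  adjacentSum g (reverse (b ∷ L)) + g b a ≡⟨ cong (_+ g b a) (adjacentSum-reverse g (b ∷ L)) ⟩
  adjacentSum (flip g) (b ∷ L) + g b a    ≡⟨ +-comm _ (g b a) ⟩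
  adjacentSum (flip g) (a ∷ b ∷ L)        ∎
  where open ≡-Reasoning

adjacentSum-second : ∀ p a L → adjacentSum (λ _ b → 𝟙 (p b)) (a ∷ L) ≡ countB p L
adjacentSum-second p a []      = refl
adjacentSum-second p a (b ∷ L) = cong (𝟙 (p b) +_) (adjacentSum-second p b L)

maklPairTerm : List ℕ → ℕ → ℕ → List ℕ → ℕ
maklPairTerm pre a b rest =
  if b <ᵇ a
     then countB (λ x → x <ᵇ b) pre
          + countB (λ z → if b <ᵇ z then z <ᵇ a else false) rest
          + countB (λ z → z <ᵇ b) rest
          + 1
     else 0

-- What an extra first entry x adds to the term of a later pair (a , b) …
prefixExtra : ℕ → ℕ → ℕ → ℕ
prefixExtra x a b = if b <ᵇ a then 𝟙 (x <ᵇ b) else 0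

-- … and what an extra last entry x adds to the term of an earlier pair (a , b).
suffixExtra : ℕ → ℕ → ℕ → ℕ
suffixExtra x a b = if b <ᵇ a then 𝟙 (if b <ᵇ x then x <ᵇ a else false) + 𝟙 (x <ᵇ b) else 0

-- The term of the new last pair (last L , x) of L ∷ʳ x.
lastPairTerm : List ℕ → ℕ → List ℕ → ℕ
lastPairTerm pre x []             = 0
lastPairTerm pre x (a ∷ [])       = if x <ᵇ a then countB (_<ᵇ x) pre + 1 else 0
lastPairTerm pre x (a ∷ b ∷ rest) = lastPairTerm (pre ++ [ a ]) x (b ∷ rest)

maklPairTerm-cons : ∀ x pre a b rest → maklPairTerm (x ∷ pre) a b rest ≡ maklPairTerm pre a b rest + prefixExtra x a b
maklPairTerm-cons x pre a b rest with b <ᵇ a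
... | true = solve 4 (λ i C R₁ R₂ → (i :+ C) :+ R₁ :+ R₂ :+ con 1 := (C :+ R₁ :+ R₂ :+ con 1) :+ i) refl
               (𝟙 (x <ᵇ b)) (countB (_<ᵇ b) pre) (countB (λ z → if b <ᵇ z then z <ᵇ a else false) rest)
               (countB (_<ᵇ b) rest)
... | false = refl

maklPairTerm-snoc : ∀ x pre a b rest → maklPairTerm pre a b (rest ∷ʳ x) ≡ maklPairTerm pre a b rest + suffixExtra x a b
maklPairTerm-snoc x pre a b rest
  rewrite countB-snoc (λ z → if b <ᵇ z then z <ᵇ a else false) rest x | countB-snoc (_<ᵇ b) rest x with b <ᵇ a
... | true = solve 5 (λ C R₁ i₁ R₂ i₂ → C :+ (R₁ :+ i₁) :+ (R₂ :+ i₂) :+ con 1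
                                     := (C :+ R₁ :+ R₂ :+ con 1) :+ (i₁ :+ i₂)) refl
               (countB (_<ᵇ b) pre) (countB (λ z → if b <ᵇ z then z <ᵇ a else false) rest)
               (𝟙 (if b <ᵇ x then x <ᵇ a else false)) (countB (_<ᵇ b) rest) (𝟙 (x <ᵇ b))
... | false = refl

maklAux-cons : ∀ x pre L → maklAux (x ∷ pre) L ≡ maklAux pre L + adjacentSum (prefixExtra x) L
maklAux-cons x pre []          = refl
maklAux-cons x pre (a ∷ [])    = refl
maklAux-cons x pre (a ∷ b ∷ L) =
  trans (cong₂ _+_ (maklPairTerm-cons x pre a b L) (maklAux-cons x (pre ++ [ a ]) (b ∷ L)))
    (+-interchange (maklPairTerm pre a b L) (prefixExtra x a b) (maklAux (pre ++ [ a ]) (b ∷ L)) _)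

maklAux-snoc : ∀ x pre L → maklAux pre (L ∷ʳ x) ≡ maklAux pre L + adjacentSum (suffixExtra x) L + lastPairTerm pre x L
maklAux-snoc x pre []       = refl
maklAux-snoc x pre (a ∷ []) with x <ᵇ a
... | true  = solve 1 (λ C → C :+ con 0 :+ con 0 :+ con 1 :+ con 0 := C :+ con 1) refl (countB (_<ᵇ x) pre)
... | false = refl
maklAux-snoc x pre (a ∷ b ∷ L) =
  trans (cong₂ _+_ (maklPairTerm-snoc x pre a b L) (maklAux-snoc x (pre ++ [ a ]) (b ∷ L)))
    (solve 5 (λ T h M P l → (T :+ h) :+ ((M :+ P) :+ l) := ((T :+ M) :+ (h :+ P)) :+ l) refl
       (maklPairTerm pre a b L) (suffixExtra x a b) (maklAux (pre ++ [ a ]) (b ∷ L))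
       (adjacentSum (suffixExtra x) (b ∷ L)) (lastPairTerm (pre ++ [ a ]) x (b ∷ L)))

lastPairTerm-snoc : ∀ pre x M c → lastPairTerm pre x (M ∷ʳ c) ≡ (if x <ᵇ c then countB (_<ᵇ x) (pre ++ M) + 1 else 0)
lastPairTerm-snoc pre x []          c rewrite ++-identityʳ pre = refl
lastPairTerm-snoc pre x (a ∷ [])    c = refl
lastPairTerm-snoc pre x (a ∷ b ∷ M) c =
  trans (lastPairTerm-snoc (pre ++ [ a ]) x (b ∷ M) c)
    (cong (λ l → if x <ᵇ c then countB (_<ᵇ x) l + 1 else 0) (++-assoc pre [ a ] (b ∷ M)))

prefixExtra+suffixExtra : ∀ x a b → x ≢ a → a ≢ b → prefixExtra x a b + suffixExtra x b a ≡ 𝟙 (x <ᵇ b)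
prefixExtra+suffixExtra x a b x≢a a≢b with <-cmp a b
... | tri≈ _ a≡b _ = ⊥-elim (a≢b a≡b)
... | tri> _ _ b<a rewrite <⇒<ᵇ≡true b<a | ≮⇒<ᵇ≡false (<-asym b<a) = +-identityʳ _
... | tri< a<b _ _ rewrite <⇒<ᵇ≡true a<b | ≮⇒<ᵇ≡false (<-asym a<b) with <-cmp x a
...   | tri≈ _ x≡a _ = ⊥-elim (x≢a x≡a)
...   | tri< x<a _ _ rewrite <⇒<ᵇ≡true x<a | ≮⇒<ᵇ≡false (<-asym x<a) | <⇒<ᵇ≡true (<-trans x<a a<b) = refl
...   | tri> _ _ a<x rewrite <⇒<ᵇ≡true a<x | ≮⇒<ᵇ≡false (<-asym a<x) = +-identityʳ _

between+below : ∀ b x z → b < x → z ≢ b → 𝟙 (if b <ᵇ z then z <ᵇ x else false) + 𝟙 (z <ᵇ b) ≡ 𝟙 (z <ᵇ x)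
between+below b x z b<x z≢b with <-cmp z b
... | tri≈ _ z≡b _ = ⊥-elim (z≢b z≡b)
... | tri< z<b _ _ rewrite <⇒<ᵇ≡true z<b | ≮⇒<ᵇ≡false (<-asym z<b) | <⇒<ᵇ≡true (<-trans z<b b<x) = refl
... | tri> _ _ b<z rewrite <⇒<ᵇ≡true b<z | ≮⇒<ᵇ≡false (<-asym b<z) = +-identityʳ _

below+above : ∀ x z → z ≢ x → 𝟙 (z <ᵇ x) + 𝟙 (x <ᵇ z) ≡ 1
below+above x z z≢x with <-cmp z x
... | tri≈ _ z≡x _ = ⊥-elim (z≢x z≡x)
... | tri< z<x _ _ rewrite <⇒<ᵇ≡true z<x | ≮⇒<ᵇ≡false (<-asym z<x) = refl
... | tri> _ _ x<z rewrite <⇒<ᵇ≡true x<z | ≮⇒<ᵇ≡false (<-asym x<z) = refl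

countB-+ : ∀ p q r L → All (λ y → 𝟙 (p y) + 𝟙 (q y) ≡ 𝟙 (r y)) L → countB p L + countB q L ≡ countB r L
countB-+ p q r []      []       = refl
countB-+ p q r (y ∷ L) (e ∷ es) =
  trans (+-interchange (𝟙 (p y)) _ (𝟙 (q y)) _)
        (cong₂ _+_ e (countB-+ p q r L es))

countB-true : ∀ L → countB (λ _ → true) L ≡ length L
countB-true []      = refl
countB-true (x ∷ L) = cong suc (countB-true L)

-- The pair formed by a first entry x and the entry b after it is a descent of exactly one of
-- σ and its reverse; either way it comes with the entries below x further on.
firstPairTerms : ∀ x b rest → x ≢ b → All (b ≢_) rest →
  maklPairTerm [] x b rest + lastPairTerm [] x (reverse (b ∷ rest)) ≡ countB (_<ᵇ x) rest + 1
firstPairTerms x b rest x≢b b∉rest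
  rewrite unfold-reverse b rest | lastPairTerm-snoc [] x (reverse rest) b | countB-↭ (_<ᵇ x) (↭-reverse rest)
  with <-cmp b x
... | tri≈ _ b≡x _ = ⊥-elim (x≢b (sym b≡x))
... | tri< b<x _ _ rewrite <⇒<ᵇ≡true b<x | ≮⇒<ᵇ≡false (<-asym b<x) =
  trans (+-identityʳ _) (cong (_+ 1) (countB-+ _ _ _ rest (All.map (λ b≢z → between+below b x _ b<x (b≢z ∘ sym)) b∉rest)))
... | tri> _ _ x<b rewrite <⇒<ᵇ≡true x<b | ≮⇒<ᵇ≡false (<-asym x<b) = refl

extraTerms : ∀ x b rest → All (x ≢_) (b ∷ rest) → Unique (b ∷ rest) →
  adjacentSum (prefixExtra x) (b ∷ rest) + adjacentSum (suffixExtra x) (reverse (b ∷ rest)) ≡ countB (x <ᵇ_) rest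
extraTerms x b rest x∉ L! = begin
  adjacentSum (prefixExtra x) L + adjacentSum (suffixExtra x) (reverse L)
    ≡⟨ cong (adjacentSum (prefixExtra x) L +_) (adjacentSum-reverse (suffixExtra x) L) ⟩
  adjacentSum (prefixExtra x) L + adjacentSum (flip (suffixExtra x)) L
    ≡⟨ adjacentSum-+ (prefixExtra x) (flip (suffixExtra x)) L ⟨
  adjacentSum (λ a c → prefixExtra x a c + suffixExtra x c a) L
    ≡⟨ adjacentSum-cong (Linked.map (λ { (x≢a , a≢c) → prefixExtra+suffixExtra x _ _ x≢a a≢c }) (Linked-apart x∉ L!)) ⟩
  adjacentSum (λ _ c → 𝟙 (x <ᵇ c)) L
    ≡⟨ adjacentSum-second (x <ᵇ_) b rest ⟩
  countB (x <ᵇ_) rest ∎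
  where
  open ≡-Reasoning
  L = b ∷ rest
  Linked-apart : ∀ {L} → All (x ≢_) L → Unique L → Linked (λ a c → x ≢ a × a ≢ c) L
  Linked-apart []                []                 = []
  Linked-apart (_ ∷ [])          (_ ∷ [])           = [-]
  Linked-apart (x≢a ∷ x∉L) ((a≢c ∷ _) ∷ L!) = (x≢a , a≢c) ∷ Linked-apart x∉L L!

triangle : ℕ → ℕ
triangle zero    = 0
triangle (suc m) = m + triangle m

makl-+-reverse : ∀ σ → Unique σ → makl σ + makl (reverse σ) ≡ triangle (length σ)
makl-+-reverse []            _ = refl
makl-+-reverse (x ∷ [])      _ = refl
makl-+-reverse (x ∷ b ∷ rest) (x∉ ∷ L!@(b∉rest ∷ _)) = begin
  makl (x ∷ τ) + makl (reverse (x ∷ τ))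
    ≡⟨ cong (λ l → makl (x ∷ τ) + makl l) (unfold-reverse x τ) ⟩
  (maklPairTerm [] x b rest + maklAux [ x ] τ) + maklAux [] (reverse τ ∷ʳ x)
    ≡⟨ cong₂ _+_ (cong (maklPairTerm [] x b rest +_) (maklAux-cons x [] τ)) (maklAux-snoc x [] (reverse τ)) ⟩
  (first + (makl τ + pre)) + ((makl (reverse τ) + suf) + lst)
    ≡⟨ solve 6 (λ f m e m′ h l → (f :+ (m :+ e)) :+ ((m′ :+ h) :+ l) := (m :+ m′) :+ ((f :+ l) :+ (e :+ h))) refl
         first (makl τ) pre (makl (reverse τ)) suf lst ⟩
  (makl τ + makl (reverse τ)) + ((first + lst) + (pre + suf))
    ≡⟨ cong₂ (λ s t → s + (t + (pre + suf))) (makl-+-reverse τ L!) (firstPairTerms x b rest (All.head x∉) b∉rest) ⟩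
  triangle (length τ) + ((countB (_<ᵇ x) rest + 1) + (pre + suf))
    ≡⟨ cong (λ t → triangle (length τ) + ((countB (_<ᵇ x) rest + 1) + t)) (extraTerms x b rest x∉ L!) ⟩
  triangle (length τ) + ((countB (_<ᵇ x) rest + 1) + countB (x <ᵇ_) rest)
    ≡⟨ cong (λ t → triangle (length τ) + (t + countB (x <ᵇ_) rest)) (+-comm _ 1) ⟩
  triangle (length τ) + suc (countB (_<ᵇ x) rest + countB (x <ᵇ_) rest)
    ≡⟨ cong (λ t → triangle (length τ) + suc t)
            (trans (countB-+ _ _ _ rest (All.map (λ x≢z → below+above x _ (x≢z ∘ sym)) (All.tail x∉))) (countB-true rest)) ⟩
  triangle (length τ) + length τ
    ≡⟨ +-comm _ (length τ) ⟩
  triangle (length (x ∷ τ)) ∎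
  where
  open ≡-Reasoning
  τ = b ∷ rest
  first = maklPairTerm [] x b rest
  pre = adjacentSum (prefixExtra x) τ
  suf = adjacentSum (suffixExtra x) (reverse τ)
  lst = lastPairTerm [] x (reverse τ)

makl-reverse-sum : ∀ n σ → InS n σ → makl σ + makl (reverse σ) ≡ triangle n
makl-reverse-sum n σ σ∈Sₙ = trans (makl-+-reverse σ (InS⇒Unique σ∈Sₙ)) (cong triangle (InS⇒length σ∈Sₙ))

¬C-homomesic-by-S₃ : (st : List ℕ → ℕ) →
  orbitSum (λ σ → ℤ.+ st σ) compMap (1 ∷ 2 ∷ 3 ∷ []) 2
    ≢ orbitSum (λ σ → ℤ.+ st σ) compMap (1 ∷ 3 ∷ 2 ∷ []) 2 →
  ∃ λ n → (1 ≤ n) × ¬ Homomesic (InS n) compMap (λ σ → ℤ.+ st σ)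
¬C-homomesic-by-S₃ st sums≢ = 3 , s≤s z≤n ,
  ¬homomesic-of-unequal-orbitSums ↭-refl (↭-prep 1 (↭-swap 3 2 ↭-refl))
    (orbitSize-two (λ ()) refl) (orbitSize-two (λ ()) refl) sums≢

R-homomesic : (st : List ℕ → ℕ) (c : ℕ → ℕ) → (∀ n σ → InS n σ → st σ + st (reverse σ) ≡ c n) →
  ∀ n → 1 ≤ n → Homomesic (InS n) revMap (λ σ → ℤ.+ st σ)
R-homomesic st c reverse-sum n _ =
  homomesic-of-involution (InS n) revMap st (c n) (λ σ _ → reverse-involutive σ) (reverse-sum n)

theorem5p6 : RHomomesicNotC load × RHomomesicNotC imaj × RHomomesicNotC disorder
             × RHomomesicNotC invIndex × RHomomesicNotC makl
theorem5p6 =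
    (R-homomesic load _ load-reverse-sum , ¬C-homomesic-by-S₃ load (λ ()))
  , (R-homomesic imaj _ imaj-reverse-sum , ¬C-homomesic-by-S₃ imaj (λ ()))
  , (R-homomesic disorder _ disorder-reverse-sum , ¬C-homomesic-by-S₃ disorder (λ ()))
  , (R-homomesic invIndex _ invIndex-reverse-sum , ¬C-homomesic-by-S₃ invIndex (λ ()))
  , (R-homomesic makl _ makl-reverse-sum , ¬C-homomesic-by-S₃ makl (λ ()))
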